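{- Let $n$, $k$ and $t$ be positive integers, and let $p$ be a fixed constant with $\frac{2}{3}\leq p<1$. If $n\geq \frac{1}{1-p}(k-t)(k+1)+2t$, then $$(1-p)\binom{n-t}{k-t}\geq (k+1)\sum_{a=0}^{t-2}\binom{n-2t-1}{n-k-t+a}+t(k+1)\binom{n-2t-1}{n-k-1}.$$
   Formalization: The constant p is rational. -}

module Defs where

open import Data.Nat using (ℕ; zero; suc)
open import Data.Nat.Combinatorics using (_C_)
open import Data.Integer using (ℤ; +_; -[1+_]; _+_)

-- Binomial coefficient with integer arguments, combinatorial convention:
-- C(m, r) = 0 if m < 0 or r < 0, and the usual m choose r otherwise
-- (which is already 0 when r > m).
binomℤ : ℤ → ℤ → ℤ
binomℤ (+ m) (+ r) = + (m C r)
binomℤ (+ m) -[1+ r ] = + 0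
binomℤ -[1+ m ] r = + 0

sumBelow : ℕ → (ℕ → ℤ) → ℤ
sumBelow zero f = + 0
sumBelow (suc m) f = sumBelow m f + f m

-- Write k = t + s with s ≥ 1 and u = n - k - t (the size condition forces u ≥ 0, since
-- 1 - p ≤ 1), so that the left-hand binomials are C(m, u + a) with m = n - 2t - 1 = s + u - 1.
-- Peeling off one term at a time with Pascal's rule bounds the bracket
-- Σ_{a<t-1} C(m, u + a) + t C(m, u + t - 1) by C(m + t, u + t), and the absorption identity
-- s C(N, s) = N C(N - 1, s - 1) with N = n - t = m + t + 1 turns this into
-- (m + 1) · bracket ≤ s C(n - t, k - t). The size condition s (k + 1) ≤ (1 - p)(m + 1) then
-- gives the claim.

module Submission where

module BinomialEstimates where
  open import Data.Nat
  open import Data.Nat.Properties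
  open import Data.Nat.Combinatorics using (_C_; nCk+nC[k+1]≡[n+1]C[k+1]; nCk≡nC[n∸k]; nC1≡n)
  open import Data.Nat.Tactic.RingSolver using (solve-∀)
  open import Relation.Binary.PropositionalEquality

  sumBelowℕ : ℕ → (ℕ → ℕ) → ℕ
  sumBelowℕ zero f = 0
  sumBelowℕ (suc j) f = sumBelowℕ j f + f j

  sumBelowℕ-cong : ∀ j {f g : ℕ → ℕ} → (∀ a → f a ≡ g a) → sumBelowℕ j f ≡ sumBelowℕ j g
  sumBelowℕ-cong zero f≗g = refl
  sumBelowℕ-cong (suc j) f≗g = cong₂ _+_ (sumBelowℕ-cong j f≗g) (f≗g j)

  sumBelowℕ-suc : ∀ j (f : ℕ → ℕ) → sumBelowℕ (suc j) f ≡ f 0 + sumBelowℕ j (λ a → f (suc a))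
  sumBelowℕ-suc zero f = +-comm 0 (f 0)
  sumBelowℕ-suc (suc j) f = begin
    sumBelowℕ (suc j) f + f (suc j)                    ≡⟨ cong (_+ f (suc j)) (sumBelowℕ-suc j f) ⟩
    f 0 + sumBelowℕ j (λ a → f (suc a)) + f (suc j)    ≡⟨ +-assoc (f 0) _ _ ⟩
    f 0 + sumBelowℕ (suc j) (λ a → f (suc a))          ∎
    where open ≡-Reasoning

  [1+n]C[1+k]≡nCk+nC[1+k] : ∀ n k → suc n C suc k ≡ n C k + n C suc k
  [1+n]C[1+k]≡nCk+nC[1+k] n k = sym (nCk+nC[k+1]≡[n+1]C[k+1] n k)

  nCk≤[d+n]C[d+k] : ∀ d n k → n C k ≤ (d + n) C (d + k)
  nCk≤[d+n]C[d+k] zero n k = ≤-refl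
  nCk≤[d+n]C[d+k] (suc d) n k = begin
    n C k                                        ≤⟨ nCk≤[d+n]C[d+k] d n k ⟩
    (d + n) C (d + k)                            ≤⟨ m≤m+n _ _ ⟩
    (d + n) C (d + k) + (d + n) C suc (d + k)    ≡⟨ [1+n]C[1+k]≡nCk+nC[1+k] (d + n) (d + k) ⟨
    suc (d + n) C suc (d + k)                    ∎
    where open ≤-Reasoning

  nCk≤[d+n]Ck : ∀ d n k → n C k ≤ (d + n) C k
  nCk≤[d+n]Ck zero n k = ≤-refl
  nCk≤[d+n]Ck (suc d) n zero = ≤-refl
  nCk≤[d+n]Ck (suc d) n (suc k) = begin
    n C suc k                                    ≤⟨ nCk≤[d+n]Ck d n (suc k) ⟩
    (d + n) C suc k                              ≤⟨ m≤n+m _ _ ⟩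
    (d + n) C k + (d + n) C suc k                ≡⟨ [1+n]C[1+k]≡nCk+nC[1+k] (d + n) k ⟨
    suc (d + n) C suc k                          ∎
    where open ≤-Reasoning

  nCk+nC[1+d+k]≤[1+d+n]C[1+d+k] : ∀ d n k → n C k + n C suc (d + k) ≤ suc (d + n) C suc (d + k)
  nCk+nC[1+d+k]≤[1+d+n]C[1+d+k] d n k = begin
    n C k + n C suc (d + k)                      ≤⟨ +-mono-≤ (nCk≤[d+n]C[d+k] d n k) (nCk≤[d+n]Ck d n (suc (d + k))) ⟩
    (d + n) C (d + k) + (d + n) C suc (d + k)    ≡⟨ [1+n]C[1+k]≡nCk+nC[1+k] (d + n) (d + k) ⟨
    suc (d + n) C suc (d + k)                    ∎
    where open ≤-Reasoning

  weightedRowSum : ℕ → ℕ → ℕ → ℕ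
  weightedRowSum j n k = sumBelowℕ j (λ a → n C (k + a)) + suc j * (n C (k + j))

  weightedRowSum≤C : ∀ j n k → weightedRowSum j n k ≤ (suc j + n) C (suc j + k)
  weightedRowSum≤C zero n k = begin
    0 + 1 * (n C (k + 0))   ≡⟨ cong (λ i → 1 * (n C i)) (+-identityʳ k) ⟩
    1 * (n C k)             ≡⟨ *-identityˡ (n C k) ⟩
    n C k                   ≤⟨ nCk≤[d+n]C[d+k] 1 n k ⟩
    suc n C suc k           ∎
    where open ≤-Reasoning
  weightedRowSum≤C (suc j) n k = begin
    weightedRowSum (suc j) n k
      ≡⟨ cong₂ (λ x y → x + suc (suc j) * (n C y)) (sumBelowℕ-suc j f) (+-suc k j) ⟩
    f 0 + sumBelowℕ j (λ a → f (suc a)) + suc (suc j) * (n C suc (k + j))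
      ≡⟨ cong (λ x → f 0 + x + suc (suc j) * (n C suc (k + j))) (sumBelowℕ-cong j (λ a → cong (n C_) (+-suc k a))) ⟩
    f 0 + sumBelowℕ j (λ a → n C (suc k + a)) + suc (suc j) * (n C (suc k + j))
      ≡⟨ regroup (f 0) (sumBelowℕ j (λ a → n C (suc k + a))) (n C (suc k + j)) j ⟩
    weightedRowSum j n (suc k) + (f 0 + n C suc (k + j))
      ≡⟨ cong (λ i → weightedRowSum j n (suc k) + (f 0 + n C suc i)) (+-comm k j) ⟩
    weightedRowSum j n (suc k) + (f 0 + n C suc (j + k))
      ≤⟨ +-mono-≤ (weightedRowSum≤C j n (suc k)) outerPair≤ ⟩
    (suc j + n) C (suc j + suc k) + (suc j + n) C (suc j + k)
      ≡⟨ cong (λ i → (suc j + n) C i + (suc j + n) C (suc j + k)) (+-suc (suc j) k) ⟩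
    (suc j + n) C suc (suc j + k) + (suc j + n) C (suc j + k)
      ≡⟨ +-comm ((suc j + n) C suc (suc j + k)) ((suc j + n) C (suc j + k)) ⟩
    (suc j + n) C (suc j + k) + (suc j + n) C suc (suc j + k)
      ≡⟨ [1+n]C[1+k]≡nCk+nC[1+k] (suc j + n) (suc j + k) ⟨
    (suc (suc j) + n) C (suc (suc j) + k) ∎
    where
    open ≤-Reasoning
    f : ℕ → ℕ
    f a = n C (k + a)
    outerPair≤ : f 0 + n C suc (j + k) ≤ (suc j + n) C (suc j + k)
    outerPair≤ = subst (λ i → n C i + n C suc (j + k) ≤ (suc j + n) C (suc j + k))
                       (sym (+-identityʳ k)) (nCk+nC[1+d+k]≤[1+d+n]C[1+d+k] j n k)
    regroup : ∀ a b c j → a + b + (2 + j) * c ≡ (b + (1 + j) * c) + (a + c)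
    regroup = solve-∀

  [1+k]*[1+n]C[1+k]≡[1+n]*nCk : ∀ n k → suc k * (suc n C suc k) ≡ suc n * (n C k)
  [1+k]*[1+n]C[1+k]≡[1+n]*nCk zero zero = refl
  [1+k]*[1+n]C[1+k]≡[1+n]*nCk zero (suc k) = *-zeroʳ (suc (suc k))
  [1+k]*[1+n]C[1+k]≡[1+n]*nCk (suc n) zero = trans (+-identityʳ (suc (suc n) C 1)) (trans (nC1≡n (suc (suc n))) (sym (*-identityʳ (suc (suc n)))))
  [1+k]*[1+n]C[1+k]≡[1+n]*nCk (suc n) (suc k) = begin
    suc (suc k) * (suc (suc n) C suc (suc k))
      ≡⟨ cong (suc (suc k) *_) ([1+n]C[1+k]≡nCk+nC[1+k] (suc n) (suc k)) ⟩
    suc (suc k) * (X + Y)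
      ≡⟨ expand k X Y ⟩
    suc k * X + X + suc (suc k) * Y
      ≡⟨ cong₂ (λ a b → a + X + b) ([1+k]*[1+n]C[1+k]≡[1+n]*nCk n k) ([1+k]*[1+n]C[1+k]≡[1+n]*nCk n (suc k)) ⟩
    suc n * (n C k) + X + suc n * (n C suc k)
      ≡⟨ collect n (n C k) X (n C suc k) ⟩
    suc n * (n C k + n C suc k) + X
      ≡⟨ cong (λ a → suc n * a + X) ([1+n]C[1+k]≡nCk+nC[1+k] n k) ⟨
    suc n * X + X
      ≡⟨ +-comm (suc n * X) X ⟩
    suc (suc n) * X ∎
    where
    open ≡-Reasoning
    X = suc n C suc k
    Y = suc n C suc (suc k)
    expand : ∀ k X Y → (2 + k) * (X + Y) ≡ (1 + k) * X + X + (2 + k) * Y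
    expand = solve-∀
    collect : ∀ n a X b → (1 + n) * a + X + (1 + n) * b ≡ (1 + n) * (a + b) + X
    collect = solve-∀

  [1+s+u]*weightedRowSum≤[1+s]*C : ∀ j s u →
    suc (s + u) * weightedRowSum j (s + u) u ≤ suc s * ((suc s + u + suc j) C suc s)
  [1+s+u]*weightedRowSum≤[1+s]*C j s u = begin
    suc m * weightedRowSum j m u         ≤⟨ *-monoʳ-≤ (suc m) (weightedRowSum≤C j m u) ⟩
    suc m * ((suc j + m) C (suc j + u))  ≤⟨ *-monoˡ-≤ _ (s≤s (m≤m+n m (suc j))) ⟩
    suc (m + suc j) * ((suc j + m) C (suc j + u))  ≡⟨ cong (suc (m + suc j) *_) symmetric ⟩
    suc (m + suc j) * ((m + suc j) C s)  ≡⟨ [1+k]*[1+n]C[1+k]≡[1+n]*nCk (m + suc j) s ⟨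
    suc s * ((suc s + u + suc j) C suc s) ∎
    where
    open ≤-Reasoning
    m = s + u
    complement : (m + suc j) ∸ s ≡ suc j + u
    complement = begin-equality
      (s + u + suc j) ∸ s    ≡⟨ cong (_∸ s) (+-assoc s u (suc j)) ⟩
      (s + (u + suc j)) ∸ s  ≡⟨ m+n∸m≡n s (u + suc j) ⟩
      u + suc j              ≡⟨ +-comm u (suc j) ⟩
      suc j + u              ∎
    symmetric : (suc j + m) C (suc j + u) ≡ (m + suc j) C s
    symmetric = begin-equality
      (suc j + m) C (suc j + u)  ≡⟨ cong₂ _C_ (+-comm (suc j) m) (sym complement) ⟩
      (m + suc j) C ((m + suc j) ∸ s)   ≡⟨ nCk≡nC[n∸k] (≤-trans (m≤m+n s u) (m≤m+n m (suc j))) ⟨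
      (m + suc j) C s ∎

module RationalFacts where
  open import Data.Nat as ℕ using (ℕ)
  open import Data.Nat.Coprimality using (1-coprimeTo)
  import Data.Nat.Coprimality as Coprime
  open import Data.Integer as ℤ using (ℤ; +_)
  import Data.Integer.Properties as ℤP
  open import Data.Rational
  open import Data.Rational.Properties
  open import Data.Empty using (⊥-elim)
  open import Data.Sum using (inj₁; inj₂)
  open import Relation.Binary.PropositionalEquality

  i/1≡mkℚi0 : ∀ i → i / 1 ≡ mkℚ i 0 (Coprime.sym (1-coprimeTo ℤ.∣ i ∣))
  i/1≡mkℚi0 (+ n) = normalize-coprime (Coprime.sym (1-coprimeTo n))
  i/1≡mkℚi0 ℤ.-[1+ n ] = cong -_ (normalize-coprime (Coprime.sym (1-coprimeTo (ℕ.suc n))))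

  /1-mono-≤ : ∀ {i j} → i ℤ.≤ j → i / 1 ≤ j / 1
  /1-mono-≤ {i} {j} i≤j rewrite i/1≡mkℚi0 i | i/1≡mkℚi0 j =
    *≤* (subst₂ ℤ._≤_ (sym (ℤP.*-identityʳ i)) (sym (ℤP.*-identityʳ j)) i≤j)

  /1-cancel-≤ : ∀ {i j} → i / 1 ≤ j / 1 → i ℤ.≤ j
  /1-cancel-≤ {i} {j} i≤j rewrite i/1≡mkℚi0 i | i/1≡mkℚi0 j with i≤j
  ... | *≤* i*1≤j*1 = subst₂ ℤ._≤_ (ℤP.*-identityʳ i) (ℤP.*-identityʳ j) i*1≤j*1

  /1-homo-* : ∀ i j → (i ℤ.* j) / 1 ≡ (i / 1) * (j / 1)
  /1-homo-* i j = sym (cong₂ _*_ (i/1≡mkℚi0 i) (i/1≡mkℚi0 j))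

  /1-mono-*-≤ : ∀ {a b c d} → a ℕ.* b ℕ.≤ c ℕ.* d → (+ a / 1) * (+ b / 1) ≤ (+ c / 1) * (+ d / 1)
  /1-mono-*-≤ {a} {b} {c} {d} ab≤cd =
    subst₂ _≤_ (/1-homo-* (+ a) (+ b)) (/1-homo-* (+ c) (+ d))
      (subst₂ (λ i j → i / 1 ≤ j / 1) (ℤP.pos-* a b) (ℤP.pos-* c d) (/1-mono-≤ (ℤ.+≤+ ab≤cd)))

  x*y≤c*z∧c≤q*x⇒y≤q*z : ∀ q {c} x y z .{{_ : Positive x}} .{{_ : NonNegative z}} →
    x * y ≤ c * z → c ≤ q * x → y ≤ q * z
  x*y≤c*z∧c≤q*x⇒y≤q*z q {c} x y z xy≤cz c≤qx = *-cancelˡ-≤-pos x (begin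
    x * y        ≤⟨ xy≤cz ⟩
    c * z        ≤⟨ *-monoʳ-≤-nonNeg z c≤qx ⟩
    q * x * z    ≡⟨ cong (_* z) (*-comm q x) ⟩
    x * q * z    ≡⟨ *-assoc x q z ⟩
    x * (q * z)  ∎)
    where open ≤-Reasoning

  x≤q*y∧q≤1⇒x≤y : ∀ {q x y} .{{_ : NonNegative q}} → 0ℚ < x → q ≤ 1ℚ → x ≤ q * y → x ≤ y
  x≤q*y∧q≤1⇒x≤y {q} {x} {y} 0<x q≤1 x≤qy with ≤-total 0ℚ y
  ... | inj₁ 0≤y = ≤-trans x≤qy (subst (q * y ≤_) (*-identityˡ y) (*-monoʳ-≤-nonNeg y {{nonNegative 0≤y}} q≤1))
  ... | inj₂ y≤0 = ⊥-elim (<-irrefl refl (<-≤-trans 0<x (≤-trans x≤qy qy≤0)))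
    where
    qy≤0 : q * y ≤ 0ℚ
    qy≤0 = subst (q * y ≤_) (*-zeroʳ q) (*-monoˡ-≤-nonNeg q y≤0)

  0<1-p : ∀ {p} → p < 1ℚ → 0ℚ < 1ℚ - p
  0<1-p {p} p<1 = subst (_< 1ℚ - p) (+-inverseʳ 1ℚ) (+-monoʳ-< 1ℚ (neg-antimono-< p<1))

  1-p≤1 : ∀ {p} → 0ℚ ≤ p → 1ℚ - p ≤ 1ℚ
  1-p≤1 {p} 0≤p = subst (1ℚ - p ≤_) (+-identityʳ 1ℚ) (+-monoʳ-≤ 1ℚ (neg-antimono-≤ 0≤p))

open import Defs
open import Data.Nat using (ℕ; _∸_)
import Data.Nat as ℕ
open import Data.Integer using (ℤ; +_)
import Data.Integer as ℤ
open import Data.Rational using (ℚ; _/_; 1ℚ; _-_; _*_; _≤_; _<_)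
import Data.Rational as ℚ
open import Data.Nat.Combinatorics using (_C_)
open import Data.Nat.Combinatorics.Specification using (k>n⇒nCk≡0)
import Data.Nat.Properties as ℕP
import Data.Integer.Properties as ℤP
import Data.Rational.Properties as ℚP
open import Algebra.Properties.CommutativeSemigroup ℕP.*-commutativeSemigroup using (x∙yz≈y∙xz)
open import Data.Integer.Tactic.RingSolver using (solve-∀)
import Data.Nat.Tactic.RingSolver as ℕ-Solver
open import Data.Product using (_,_)
open import Relation.Nullary using (yes; no)
open import Relation.Binary.PropositionalEquality
open BinomialEstimates using (sumBelowℕ; weightedRowSum; [1+s+u]*weightedRowSum≤[1+s]*C)
open RationalFacts

SizeCondition : ℕ → ℕ → ℕ → ℚ → Set
SizeCondition n k t p = (((+ k ℤ.- + t) ℤ.* (+ k ℤ.+ + 1)) / 1) ≤ (1ℚ - p) * ((+ n ℤ.- + 2 ℤ.* + t) / 1)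

lhs : ℕ → ℕ → ℕ → ℤ
lhs n k t = (+ k ℤ.+ + 1) ℤ.* sumBelow (t ∸ 1) (λ a → binomℤ (+ n ℤ.- + 2 ℤ.* + t ℤ.- + 1) (+ n ℤ.- + k ℤ.- + t ℤ.+ + a))
            ℤ.+ + t ℤ.* (+ k ℤ.+ + 1) ℤ.* binomℤ (+ n ℤ.- + 2 ℤ.* + t ℤ.- + 1) (+ n ℤ.- + k ℤ.- + 1)

Bound : ℕ → ℕ → ℕ → ℚ → Set
Bound n k t p = lhs n k t / 1 ≤ (1ℚ - p) * (binomℤ (+ n ℤ.- + t) (+ k ℤ.- + t) / 1)

sumBelow-cong : ∀ j {f g : ℕ → ℤ} → (∀ a → f a ≡ g a) → sumBelow j f ≡ sumBelow j g
sumBelow-cong ℕ.zero f≗g = refl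
sumBelow-cong (ℕ.suc j) f≗g = cong₂ ℤ._+_ (sumBelow-cong j f≗g) (f≗g j)

sumBelow-zero : ∀ j {f : ℕ → ℤ} → (∀ a → f a ≡ + 0) → sumBelow j f ≡ + 0
sumBelow-zero ℕ.zero f≗0 = refl
sumBelow-zero (ℕ.suc j) f≗0 = cong₂ ℤ._+_ (sumBelow-zero j f≗0) (f≗0 j)

sumBelow-pos : ∀ j (f : ℕ → ℕ) → sumBelow j (λ a → + f a) ≡ + sumBelowℕ j f
sumBelow-pos ℕ.zero f = refl
sumBelow-pos (ℕ.suc j) f = cong (ℤ._+ + f j) (sumBelow-pos j f)

binomℤ/1-nonNeg : ∀ x y → ℚ.NonNegative (binomℤ x y / 1)
binomℤ/1-nonNeg (+ m) (+ r) = ℚP.normalize-nonNeg (m C r) 1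
binomℤ/1-nonNeg (+ m) ℤ.-[1+ r ] = _
binomℤ/1-nonNeg ℤ.-[1+ m ] y = _

binomℤ-vanish : ∀ x j → binomℤ x (x ℤ.+ + ℕ.suc j) ≡ + 0
binomℤ-vanish (+ m) j = cong +_ (k>n⇒nCk≡0 (ℕP.m<m+n m (ℕ.s≤s ℕ.z≤n)))
binomℤ-vanish ℤ.-[1+ m ] j = refl

+c≤+n-+b⇒b+c≤n : ∀ {b c n} → + c ℤ.≤ + n ℤ.- + b → b ℕ.+ c ℕ.≤ n
+c≤+n-+b⇒b+c≤n {b} {c} {n} c≤n-b = ℤP.drop‿+≤+ (begin
  + (b ℕ.+ c)           ≡⟨ ℤP.+-comm (+ b) (+ c) ⟩
  + c ℤ.+ + b           ≤⟨ ℤP.+-monoˡ-≤ (+ b) c≤n-b ⟩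
  + n ℤ.- + b ℤ.+ + b   ≡⟨ cancel (+ n) (+ b) ⟩
  + n                   ∎)
  where
  open ℤP.≤-Reasoning
  cancel : ∀ N B → N ℤ.- B ℤ.+ B ≡ N
  cancel = solve-∀

-- In both cases the integer ring identities, instantiated at naturals under +_, are definitionally
-- the required equations about n, k and t, because addition of non-negative integers computes.

-- When k ≤ t every binomial coefficient on the left has lower index above its upper index.
module Case-k≤t (n k' d : ℕ) where
  k = ℕ.suc k'
  t = k ℕ.+ d
  X = + n ℤ.- + 2 ℤ.* + t ℤ.- + 1

  lhs≡0 : lhs n k t ≡ + 0
  lhs≡0 = trans
    (cong₂ (λ σ y → (+ k ℤ.+ + 1) ℤ.* σ ℤ.+ + t ℤ.* (+ k ℤ.+ + 1) ℤ.* y)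
      (sumBelow-zero (t ∸ 1) (λ a → trans (cong (binomℤ X) (n-k-t+a (+ n) (+ k') (+ d) (+ a))) (binomℤ-vanish X (d ℕ.+ a))))
      (trans (cong (binomℤ X) (n-k-1 (+ n) (+ k') (+ d))) (binomℤ-vanish X (k' ℕ.+ d ℕ.+ d))))
    (cong₂ ℤ._+_ (ℤP.*-zeroʳ (+ k ℤ.+ + 1)) (ℤP.*-zeroʳ (+ t ℤ.* (+ k ℤ.+ + 1))))
    where
    n-k-t+a : ∀ N K' D A → let K = + 1 ℤ.+ K' ; T = K ℤ.+ D in
      N ℤ.- K ℤ.- T ℤ.+ A ≡ (N ℤ.- + 2 ℤ.* T ℤ.- + 1) ℤ.+ (+ 1 ℤ.+ (D ℤ.+ A))
    n-k-t+a = solve-∀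
    n-k-1 : ∀ N K' D → let K = + 1 ℤ.+ K' ; T = K ℤ.+ D in
      N ℤ.- K ℤ.- + 1 ≡ (N ℤ.- + 2 ℤ.* T ℤ.- + 1) ℤ.+ (+ 1 ℤ.+ (K' ℤ.+ D ℤ.+ D))
    n-k-1 = solve-∀

  bound : ∀ p → p < 1ℚ → Bound n k t p
  bound p p<1 = begin
    lhs n k t / 1  ≡⟨ cong (_/ 1) lhs≡0 ⟩
    ℚ.0ℚ           ≤⟨ ℚP.nonNegative⁻¹ (q * b) {{q*b-nonNeg}} ⟩
    q * b          ∎
    where
    open ℚP.≤-Reasoning
    q = 1ℚ - p
    b = binomℤ (+ n ℤ.- + t) (+ k ℤ.- + t) / 1
    q*b-nonNeg : ℚ.NonNegative (q * b)
    q*b-nonNeg = ℚP.nonNeg*nonNeg⇒nonNeg q {{ℚ.nonNegative (ℚP.<⇒≤ (0<1-p p<1))}} b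
                   {{binomℤ/1-nonNeg (+ n ℤ.- + t) (+ k ℤ.- + t)}}

module Case-t<k (t' s' : ℕ) where
  t = ℕ.suc t'
  s = ℕ.suc s'
  k = ℕ.suc (t ℕ.+ s')
  K = k ℕ.+ 1
  c = s ℕ.* K

  k-t≡s : + k ℤ.- + t ≡ + s
  k-t≡s = identity (+ t') (+ s')
    where
    identity : ∀ T' S' → let T = + 1 ℤ.+ T' ; K = + 1 ℤ.+ (T ℤ.+ S') in K ℤ.- T ≡ + 1 ℤ.+ S'
    identity = solve-∀

  size-condition : ∀ n p → SizeCondition n k t p → + c / 1 ≤ (1ℚ - p) * ((+ n ℤ.- + 2 ℤ.* + t) / 1)
  size-condition n p = subst (λ i → i / 1 ≤ (1ℚ - p) * ((+ n ℤ.- + 2 ℤ.* + t) / 1))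
    (trans (cong (ℤ._* + K) k-t≡s) (sym (ℤP.pos-* s K)))

  -- The hypothesis p ≥ 2/3 of the theorem is used only here, and only as p ≥ 0.
  size-condition⇒t+k≤n : ∀ n {p} → ℚ.0ℚ ≤ p → p < 1ℚ → SizeCondition n k t p → t ℕ.+ k ℕ.≤ n
  size-condition⇒t+k≤n n {p} 0≤p p<1 size = begin
    t ℕ.+ k          ≡⟨ t+k≡2t+s t s' ⟩
    2 ℕ.* t ℕ.+ s    ≤⟨ ℕP.+-monoʳ-≤ (2 ℕ.* t) (ℕP.m≤m*n s K) ⟩
    2 ℕ.* t ℕ.+ c    ≤⟨ +c≤+n-+b⇒b+c≤n {2 ℕ.* t} (subst (λ i → + c ℤ.≤ + n ℤ.- i) (sym (ℤP.pos-* 2 t)) c≤n-2t) ⟩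
    n                ∎
    where
    open ℕP.≤-Reasoning
    c≤n-2t : + c ℤ.≤ + n ℤ.- + 2 ℤ.* + t
    c≤n-2t = /1-cancel-≤ (x≤q*y∧q≤1⇒x≤y {{ℚ.nonNegative (ℚP.<⇒≤ (0<1-p p<1))}}
               (ℚP.positive⁻¹ (+ c / 1) {{ℚP.normalize-pos c 1}}) (1-p≤1 0≤p) (size-condition n p size))
    t+k≡2t+s : ∀ t s' → t ℕ.+ ℕ.suc (t ℕ.+ s') ≡ 2 ℕ.* t ℕ.+ ℕ.suc s'
    t+k≡2t+s = ℕ-Solver.solve-∀

  module _ (u : ℕ) where
    n = t ℕ.+ k ℕ.+ u
    m = s' ℕ.+ u
    W = weightedRowSum t' m u
    B = (s ℕ.+ u ℕ.+ t) C s

    n-2t≡1+m : + n ℤ.- + 2 ℤ.* + t ≡ + ℕ.suc m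
    n-2t≡1+m = identity (+ t') (+ s') (+ u)
      where
      identity : ∀ T' S' U → let T = + 1 ℤ.+ T' ; K = + 1 ℤ.+ (T ℤ.+ S') ; N = T ℤ.+ K ℤ.+ U in
        N ℤ.- + 2 ℤ.* T ≡ + 1 ℤ.+ S' ℤ.+ U
      identity = solve-∀

    binom≡ : binomℤ (+ n ℤ.- + t) (+ k ℤ.- + t) ≡ + B
    binom≡ = cong₂ binomℤ (identity (+ t') (+ s') (+ u)) k-t≡s
      where
      identity : ∀ T' S' U → let T = + 1 ℤ.+ T' ; K = + 1 ℤ.+ (T ℤ.+ S') ; N = T ℤ.+ K ℤ.+ U in
        N ℤ.- T ≡ + 1 ℤ.+ S' ℤ.+ U ℤ.+ T
      identity = solve-∀

    lhs≡ : lhs n k t ≡ + (K ℕ.* W)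
    lhs≡ = begin
      lhs n k t
        ≡⟨ cong₂ (λ σ y → + K ℤ.* σ ℤ.+ + t ℤ.* + K ℤ.* y)
             (sumBelow-cong t' (λ a → cong₂ binomℤ n-2t-1≡m (n-k-t+a (+ t') (+ s') (+ u) (+ a))))
             (cong₂ binomℤ n-2t-1≡m (n-k-1 (+ t') (+ s') (+ u))) ⟩
      + K ℤ.* sumBelow t' (λ a → + (m C (u ℕ.+ a))) ℤ.+ + t ℤ.* + K ℤ.* + Y
        ≡⟨ cong (λ σ → + K ℤ.* σ ℤ.+ + t ℤ.* + K ℤ.* + Y) (sumBelow-pos t' (λ a → m C (u ℕ.+ a))) ⟩
      + K ℤ.* + Σ ℤ.+ + t ℤ.* + K ℤ.* + Y
        ≡⟨ distrib (+ K) (+ Σ) (+ t) (+ Y) ⟩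
      + K ℤ.* (+ Σ ℤ.+ + t ℤ.* + Y)
        ≡⟨ cong (λ y → + K ℤ.* (+ Σ ℤ.+ y)) (ℤP.pos-* t Y) ⟨
      + K ℤ.* + W
        ≡⟨ ℤP.pos-* K W ⟨
      + (K ℕ.* W) ∎
      where
      open ≡-Reasoning
      Σ = sumBelowℕ t' (λ a → m C (u ℕ.+ a))
      Y = m C (u ℕ.+ t')
      n-2t-1≡m : + n ℤ.- + 2 ℤ.* + t ℤ.- + 1 ≡ + m
      n-2t-1≡m = cong (ℤ._- + 1) n-2t≡1+m
      n-k-t+a : ∀ T' S' U A → let T = + 1 ℤ.+ T' ; K = + 1 ℤ.+ (T ℤ.+ S') ; N = T ℤ.+ K ℤ.+ U in
        N ℤ.- K ℤ.- T ℤ.+ A ≡ U ℤ.+ A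
      n-k-t+a = solve-∀
      n-k-1 : ∀ T' S' U → let T = + 1 ℤ.+ T' ; K = + 1 ℤ.+ (T ℤ.+ S') ; N = T ℤ.+ K ℤ.+ U in
        N ℤ.- K ℤ.- + 1 ≡ U ℤ.+ T'
      n-k-1 = solve-∀
      distrib : ∀ K S T Y → K ℤ.* S ℤ.+ T ℤ.* K ℤ.* Y ≡ K ℤ.* (S ℤ.+ T ℤ.* Y)
      distrib = solve-∀

    [1+m]*[K*W]≤c*B : ℕ.suc m ℕ.* (K ℕ.* W) ℕ.≤ c ℕ.* B
    [1+m]*[K*W]≤c*B = begin
      ℕ.suc m ℕ.* (K ℕ.* W)  ≡⟨ x∙yz≈y∙xz (ℕ.suc m) K W ⟩
      K ℕ.* (ℕ.suc m ℕ.* W)  ≤⟨ ℕP.*-monoʳ-≤ K ([1+s+u]*weightedRowSum≤[1+s]*C t' s' u) ⟩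
      K ℕ.* (s ℕ.* B)        ≡⟨ x∙yz≈y∙xz K s B ⟩
      s ℕ.* (K ℕ.* B)        ≡⟨ ℕP.*-assoc s K B ⟨
      c ℕ.* B                ∎
      where open ℕP.≤-Reasoning

    bound : ∀ p → SizeCondition n k t p → Bound n k t p
    bound p size = subst₂ (λ i j → i / 1 ≤ (1ℚ - p) * (j / 1)) (sym lhs≡) (sym binom≡)
      (x*y≤c*z∧c≤q*x⇒y≤q*z (1ℚ - p) (+ ℕ.suc m / 1) (+ (K ℕ.* W) / 1) (+ B / 1)
        {{ℚP.normalize-pos (ℕ.suc m) 1}} {{ℚP.normalize-nonNeg B 1}}
        (/1-mono-*-≤ {ℕ.suc m} {K ℕ.* W} {c} {B} [1+m]*[K*W]≤c*B)
        (subst (λ i → + c / 1 ≤ (1ℚ - p) * (i / 1)) n-2t≡1+m (size-condition n p size)))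

lemma2p2 : (n k t : ℕ) → ℕ.NonZero n → ℕ.NonZero k → ℕ.NonZero t →
    (p : ℚ) → (+ 2 / 3) ≤ p → p < 1ℚ →
    (((+ k ℤ.- + t) ℤ.* (+ k ℤ.+ + 1)) / 1) ≤ (1ℚ - p) * ((+ n ℤ.- + 2 ℤ.* + t) / 1) →
    (((+ k ℤ.+ + 1) ℤ.* sumBelow (t ∸ 1) (λ a → binomℤ (+ n ℤ.- + 2 ℤ.* + t ℤ.- + 1) (+ n ℤ.- + k ℤ.- + t ℤ.+ + a))
             ℤ.+ + t ℤ.* (+ k ℤ.+ + 1) ℤ.* binomℤ (+ n ℤ.- + 2 ℤ.* + t ℤ.- + 1) (+ n ℤ.- + k ℤ.- + 1)) / 1)
      ≤ (1ℚ - p) * ((binomℤ (+ n ℤ.- + t) (+ k ℤ.- + t)) / 1)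
lemma2p2 n k ℕ.zero _ _ () p 2/3≤p p<1 size
lemma2p2 n ℕ.zero (ℕ.suc t') _ () _ p 2/3≤p p<1 size
lemma2p2 n (ℕ.suc k') (ℕ.suc t') _ _ _ p 2/3≤p p<1 size with ℕ.suc k' ℕ.≤? ℕ.suc t'
... | yes k≤t with ℕP.m≤n⇒∃[o]m+o≡n k≤t
...   | d , refl = Case-k≤t.bound n k' d p p<1
lemma2p2 n (ℕ.suc k') (ℕ.suc t') _ _ _ p 2/3≤p p<1 size | no k≰t with ℕP.m≤n⇒∃[o]m+o≡n (ℕP.≰⇒> k≰t)
... | s' , refl with ℕP.m≤n⇒∃[o]m+o≡n
                       (Case-t<k.size-condition⇒t+k≤n t' s' n (ℚP.≤-trans (ℚP.nonNegative⁻¹ (+ 2 / 3)) 2/3≤p) p<1 size)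
...   | u , refl = Case-t<k.bound t' s' u p size
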